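{- Let $S=(s_1,s_2,s_3,\ldots)$ be a doubly fractal sequence. Then there is a positive integer $n$ such that $S$ begins with one of the two initial segments $(1,2,3,\ldots,n,1)$ or $(\underbrace{1,1,\ldots,1}_{n},2)$; that is, either $s_k=k$ for $1\le k\le n$ and $s_{n+1}=1$, or $s_k=1$ for $1\le k\le n$ and $s_{n+1}=2$.
   Context: All sequences are sequences $S=(s_1,s_2,\ldots)$ of positive integers, and $S(k)=s_k$ denotes the $k$th term. Suppose every positive integer occurs in $S$. The upper trimmed subsequence $\wedge_S$ is the sequence that remains after the first occurrence of every positive integer is removed from $S$. The lower trimmed subsequence $\vee_S$ is the sequence that remains after $1$ is subtracted from every term of $S$ and then all terms equal to $0$ are removed. A sequence $S$ in which every positive integer occurs is called doubly fractal if $s_1=1$ and $\wedge_S=\vee_S=S$. -}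

module Defs where

open import Data.Nat using (ℕ; zero; suc; _<_; _≤_; _∸_; _≥_)
open import Data.Product using (Σ; ∃; _×_; _,_)
open import Relation.Binary.PropositionalEquality using (_≡_)
open import Relation.Nullary using (¬_)

-- A sequence S = (s_1, s_2, ...) is represented 0-indexed:
-- Seq S means S : ℕ → ℕ with S k = s_(k+1).
Seq : Set
Seq = ℕ → ℕ

Positive : Seq → Set
Positive S = ∀ k → 1 ≤ S k

EveryPosOccurs : Seq → Set
EveryPosOccurs S = ∀ m → 1 ≤ m → ∃ λ k → S k ≡ m

StrictlyIncreasing : (ℕ → ℕ) → Set
StrictlyIncreasing f = ∀ i j → i < j → f i < f j

-- f enumerates, in increasing order, exactly the positions satisfying P
-- (so the subsequence of S at positions in P is  k ↦ S (f k)  and is infinite)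
Enumerates : (ℕ → Set) → (ℕ → ℕ) → Set
Enumerates P f = StrictlyIncreasing f × (∀ i → (P i → ∃ λ k → f k ≡ i) × (∀ k → P (f k)))

NotFirstOcc : Seq → ℕ → Set
NotFirstOcc S i = ∃ λ j → j < i × S j ≡ S i

IsUpperTrimmed : Seq → Seq → Set
IsUpperTrimmed S T = Σ (ℕ → ℕ) λ f → Enumerates (NotFirstOcc S) f × (∀ k → T k ≡ S (f k))

-- T is the lower trimmed subsequence of S: subtract 1 from every term,
-- then remove all terms equal to 0 (i.e. keep positions with s ≥ 2)
IsLowerTrimmed : Seq → Seq → Set
IsLowerTrimmed S T = Σ (ℕ → ℕ) λ f → Enumerates (λ i → 2 ≤ S i) f × (∀ k → T k ≡ S (f k) ∸ 1)

DoublyFractal : Seq → Set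
DoublyFractal S = Positive S × EveryPosOccurs S × S 0 ≡ 1
                × IsUpperTrimmed S S × IsLowerTrimmed S S

{-# OPTIONS --safe #-}
module Submission where

-- Since S is its own lower trimmed subsequence, s₁ is the first term ≥ 2 of S
-- minus one, so that term is 2 and every earlier term is 1. Hence S always
-- begins with (1, …, 1, 2), where n ≥ 1 because s₁ = 1.

open import Defs
open import Data.Nat using (ℕ; zero; suc; _<_; _≤_; _∸_; z≤n; s≤s; z<s)
open import Data.Nat.Properties using (≤-refl; <⇒≤; <⇒≱; n≢0⇒n>0)
open import Data.Product using (∃; _×_; _,_; proj₁)
open import Data.Sum using (_⊎_; inj₂)
open import Relation.Nullary using (¬_)
open import Relation.Binary.PropositionalEquality using (_≡_; refl; sym; trans; subst)

StrictlyIncreasing⇒head-≤ : ∀ {f} → StrictlyIncreasing f → ∀ k → f 0 ≤ f k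
StrictlyIncreasing⇒head-≤ inc zero    = ≤-refl
StrictlyIncreasing⇒head-≤ inc (suc k) = <⇒≤ (inc 0 (suc k) z<s)

Enumerates⇒head-least : ∀ {P f i} → Enumerates P f → P i → f 0 ≤ i
Enumerates⇒head-least (inc , enumerated) p with proj₁ (enumerated _) p
... | k , refl = StrictlyIncreasing⇒head-≤ inc k

m∸1≡1⇒m≡2 : ∀ {m} → m ∸ 1 ≡ 1 → m ≡ 2
m∸1≡1⇒m≡2 {suc m} refl = refl

1≤m≱2⇒m≡1 : ∀ {m} → 1 ≤ m → ¬ 2 ≤ m → m ≡ 1
1≤m≱2⇒m≡1 {suc zero}    _ _   = refl
1≤m≱2⇒m≡1 {suc (suc m)} _ m≱2 with () ← m≱2 (s≤s (s≤s z≤n))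

lemma5 : (S : Seq) → DoublyFractal S →
    ∃ λ n → 1 ≤ n ×
    (((∀ k → k < n → S k ≡ suc k) × S n ≡ 1)
    ⊎ ((∀ k → k < n → S k ≡ 1) × S n ≡ 2))
lemma5 S (positive , _ , S0≡1 , _ , (f , enum , lower)) =
  f 0 , 1≤f0 , inj₂ (onesBefore , Sf0≡2)
  where
  Sf0≡2 : S (f 0) ≡ 2
  Sf0≡2 = m∸1≡1⇒m≡2 (trans (sym (lower 0)) S0≡1)

  1≤f0 : 1 ≤ f 0
  1≤f0 = n≢0⇒n>0 λ f0≡0 → 1≢2 (trans (sym S0≡1) (subst (λ i → S i ≡ 2) f0≡0 Sf0≡2))
    where
    1≢2 : ¬ 1 ≡ 2
    1≢2 ()

  onesBefore : ∀ k → k < f 0 → S k ≡ 1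
  onesBefore k k<f0 =
    1≤m≱2⇒m≡1 (positive k) λ 2≤Sk → <⇒≱ k<f0 (Enumerates⇒head-least enum 2≤Sk)
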